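{- Let $T[1..n]$ be a string as described in the context and let $r$ be the number of runs of its BWT. Then the number of minimal unique substrings of $T$ is less than $2r$.
   Context: Alphabet $\Sigma_{\$}=[1..\sigma]$ is ordered with smallest character $\$$. $T[1..n]$ ($n\ge 2$) contains every character of $\Sigma_{\$}$, $T[n]=\$$ and $\$$ does not occur in $T[1..n-1]$. A position $b$ is an occurrence of $x$ if $T[b..b+|x|-1]=x$; $x$ is a repeat if it has at least two occurrences (the empty string counts as a repeat) and unique if it has exactly one. A minimal unique substring (MUS) is a nonempty interval $[b..e]\subseteq[1..n]$ such that $T[b..e]$ is unique while $T[b+1..e]$ and $T[b..e-1]$ are repeats. The suffix array $\mathsf{SA}$ lists starting positions of nonempty suffixes of $T$ in lexicographic order; the BWT is $\mathsf{L}[i]=T[\mathsf{SA}[i]-1]$ (with $T[0]=\$$); $r$ is the number of maximal runs of equal characters in $\mathsf{L}$. -}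

module Defs where

open import Data.Nat using (ℕ; zero; suc; _+_; _*_; _∸_; _≤_; _<_; _≡ᵇ_; _≤ᵇ_; _<ᵇ_)
open import Data.Bool using (Bool; true; false; _∧_; not; if_then_else_)
open import Data.List using (List; []; _∷_; map; upTo; concatMap; length)
open import Data.Nat.ListAction using (sum)
open import Data.Bool.ListAction using (all)
open import Data.Sum using (_⊎_)
open import Data.Product using (_×_; _,_; ∃-syntax)
open import Relation.Binary.PropositionalEquality using (_≡_; _≢_)

-- Conventions: a text is T : ℕ → ℕ together with its length n; only the
-- values T 1 , … , T n matter (1-indexed positions).  Characters are
-- naturals in [1..σ]; the character $ is 1 (the smallest).

interval : ℕ → ℕ → List ℕ
interval a b = map (λ k → a + k) (upTo (suc b ∸ a))

occursAt : (n : ℕ) (T : ℕ → ℕ) (b len c : ℕ) → Bool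
occursAt n T b len c =
  (1 ≤ᵇ c) ∧ (c + len ≤ᵇ suc n) ∧ all (λ k → T (c + k) ≡ᵇ T (b + k)) (upTo len)

-- number of occurrences of T[b..b+len-1] (the empty string has n occurrences)
occCount : (n : ℕ) (T : ℕ → ℕ) (b len : ℕ) → ℕ
occCount n T b len =
  sum (map (λ c → if occursAt n T b len c then 1 else 0) (interval 1 n))

isUnique : (n : ℕ) (T : ℕ → ℕ) (b len : ℕ) → Bool
isUnique n T b len = occCount n T b len ≡ᵇ 1

isRepeat : (n : ℕ) (T : ℕ → ℕ) (b len : ℕ) → Bool
isRepeat n T b len = 2 ≤ᵇ occCount n T b len

isMUS : (n : ℕ) (T : ℕ → ℕ) (b e : ℕ) → Bool
isMUS n T b e =
  (1 ≤ᵇ b) ∧ (b ≤ᵇ e) ∧ (e ≤ᵇ n)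
  ∧ isUnique n T b (suc e ∸ b)
  ∧ isRepeat n T (suc b) (e ∸ b)
  ∧ isRepeat n T b (e ∸ b)

numMUS : (n : ℕ) (T : ℕ → ℕ) → ℕ
numMUS n T =
  sum (concatMap (λ b → map (λ e → if isMUS n T b e then 1 else 0) (interval b n))
                 (interval 1 n))

SuffixLess : (n : ℕ) (T : ℕ → ℕ) (p q : ℕ) → Set
SuffixLess n T p q =
  ∃[ k ] ((∀ m → m < k → T (p + m) ≡ T (q + m))
         × ((n < p + k × q + k ≤ n)
            ⊎ (p + k ≤ n × q + k ≤ n × T (p + k) < T (q + k))))

IsSuffixArray : (n : ℕ) (T : ℕ → ℕ) (SA : ℕ → ℕ) → Set
IsSuffixArray n T SA =
  (∀ i → 1 ≤ i → i ≤ n → 1 ≤ SA i × SA i ≤ n)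
  × (∀ i j → 1 ≤ i → i < j → j ≤ n → SuffixLess n T (SA i) (SA j))

-- BWT: L[i] = T[SA[i]-1], with T[0] = $ (= 1)
BWT : (n : ℕ) (T : ℕ → ℕ) (SA : ℕ → ℕ) → ℕ → ℕ
BWT n T SA i with SA i
... | zero = 1
... | suc zero = 1
... | suc (suc p) = T (suc p)

-- number of maximal runs of equal characters in L[1..n] (n ≥ 1):
-- 1 + number of i ∈ [1..n-1] with L[i] ≠ L[i+1]
runs : (n : ℕ) (T : ℕ → ℕ) (SA : ℕ → ℕ) → ℕ
runs n T SA =
  suc (sum (map (λ i → if BWT n T SA i ≡ᵇ BWT n T SA (suc i) then 0 else 1)
                (interval 1 (n ∸ 1))))

ValidText : (σ n : ℕ) (T : ℕ → ℕ) → Set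
ValidText σ n T =
  (2 ≤ n)
  × (∀ i → 1 ≤ i → i ≤ n → 1 ≤ T i × T i ≤ σ)
  × (∀ c → 1 ≤ c → c ≤ σ → ∃[ i ] (1 ≤ i × i ≤ n × T i ≡ c))
  × (T n ≡ 1)
  × (∀ i → 1 ≤ i → i < n → T i ≢ 1)

module Submission where

-- At most one MUS starts at each position. A MUS [b..e] with b < n is read off at the rank i
-- of the suffix T[b+1..n], where the BWT holds T[b]. As T[b+1..e] repeats, the ranks of its
-- occurrences form an interval containing i and some other rank; the neighbour of i inside that
-- interval also starts with T[b+1..e], so if its BWT letter were T[b] then T[b..e] would not be
-- unique. Hence i is the first or the last position of its BWT run, i.e. one of the two
-- positions around one of the r - 1 run changes, and different starts b get different such
-- slots. With the start b = n this leaves at most 2(r - 1) + 1 < 2r MUSs.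

open import Defs
open import Data.Bool.ListAction using (all)
open import Data.Bool using (Bool; true; false; T; _∧_; not; if_then_else_)
open import Data.Bool.Properties using (T-≡; ∧-identityʳ)
open import Data.Empty using (⊥-elim)
open import Data.List using (List; []; _∷_; map; applyUpTo; concatMap)
open import Data.Nat using (ℕ; zero; suc; _+_; _*_; _∸_; pred; _≤_; _<_; z≤n; s≤s; s≤s⁻¹; z<s; s<s; _≡ᵇ_; _≤ᵇ_; _≤?_)
open import Data.Nat.ListAction using (sum)
open import Data.Nat.ListAction.Properties using (sum-++)
open import Data.Nat.Properties
open import Data.Nat.Tactic.RingSolver using (solve-∀)
open import Data.Product using (Σ; _×_; _,_; proj₁; proj₂; ∃-syntax)
open import Data.Sum using (_⊎_; inj₁; inj₂; [_,_]′)
open import Data.Sum.Properties using (inj₁-injective)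
open import Function using (_∘_; id; Equivalence)
open import Relation.Binary.PropositionalEquality
open import Relation.Binary.Definitions using (tri<; tri≈; tri>)
open import Relation.Nullary using (¬_; yes; no; contradiction)

∧-true⁻ : ∀ a {b} → a ∧ b ≡ true → a ≡ true × b ≡ true
∧-true⁻ true p = refl , p

≡ᵇ-true⇒≡ : ∀ {m n} → (m ≡ᵇ n) ≡ true → m ≡ n
≡ᵇ-true⇒≡ {m} {n} = ≡ᵇ⇒≡ m n ∘ Equivalence.from T-≡

≡⇒≡ᵇ-true : ∀ {m n} → m ≡ n → (m ≡ᵇ n) ≡ true
≡⇒≡ᵇ-true {m} {n} = Equivalence.to T-≡ ∘ ≡⇒≡ᵇ m n

≢⇒≡ᵇ-false : ∀ {m n} → m ≢ n → (m ≡ᵇ n) ≡ false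
≢⇒≡ᵇ-false {m} {n} m≢n with m ≡ᵇ n in eq
... | true  = contradiction (≡ᵇ-true⇒≡ eq) m≢n
... | false = refl

≤ᵇ-true⇒≤ : ∀ {m n} → (m ≤ᵇ n) ≡ true → m ≤ n
≤ᵇ-true⇒≤ {m} {n} = ≤ᵇ⇒≤ m n ∘ Equivalence.from T-≡

≤⇒≤ᵇ-true : ∀ {m n} → m ≤ n → (m ≤ᵇ n) ≡ true
≤⇒≤ᵇ-true = Equivalence.to T-≡ ∘ ≤⇒≤ᵇ

-- Counting below a bound

sumBelow : (ℕ → ℕ) → ℕ → ℕ
sumBelow f zero    = 0
sumBelow f (suc k) = f 0 + sumBelow (f ∘ suc) k

sumBelow-mono : ∀ k {f g : ℕ → ℕ} → (∀ j → j < k → f j ≤ g j) → sumBelow f k ≤ sumBelow g k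
sumBelow-mono zero    f≤g = z≤n
sumBelow-mono (suc k) f≤g = +-mono-≤ (f≤g 0 z<s) (sumBelow-mono k (λ j → f≤g (suc j) ∘ s<s))

sumBelow-cong : ∀ k {f g : ℕ → ℕ} → (∀ j → j < k → f j ≡ g j) → sumBelow f k ≡ sumBelow g k
sumBelow-cong zero    f≡g = refl
sumBelow-cong (suc k) f≡g = cong₂ _+_ (f≡g 0 z<s) (sumBelow-cong k (λ j → f≡g (suc j) ∘ s<s))

sumBelow-suc : ∀ k (f : ℕ → ℕ) → sumBelow f (suc k) ≡ sumBelow f k + f k
sumBelow-suc zero    f = +-comm (f 0) 0
sumBelow-suc (suc k) f = trans (cong (f 0 +_) (sumBelow-suc k (f ∘ suc))) (sym (+-assoc (f 0) _ _))

sum-map-map-applyUpTo : ∀ k (f g h : ℕ → ℕ) →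
  sum (map f (map g (applyUpTo h k))) ≡ sumBelow (f ∘ g ∘ h) k
sum-map-map-applyUpTo zero    f g h = refl
sum-map-map-applyUpTo (suc k) f g h = cong (f (g (h 0)) +_) (sum-map-map-applyUpTo k f g (h ∘ suc))

sum-map-interval : ∀ (f : ℕ → ℕ) a b → sum (map f (interval a b)) ≡ sumBelow (λ j → f (a + j)) (suc b ∸ a)
sum-map-interval f a b = sum-map-map-applyUpTo (suc b ∸ a) f (a +_) id

sum-concatMap : ∀ {A : Set} (F : A → List ℕ) xs → sum (concatMap F xs) ≡ sum (map (sum ∘ F) xs)
sum-concatMap F []       = refl
sum-concatMap F (x ∷ xs) = trans (sum-++ (F x) _) (cong (sum (F x) +_) (sum-concatMap F xs))

indicator : Bool → ℕ
indicator b = if b then 1 else 0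

count : (ℕ → Bool) → ℕ → ℕ
count P = sumBelow (indicator ∘ P)

_∖_ : (ℕ → Bool) → ℕ → ℕ → Bool
(P ∖ y) z = P z ∧ not (z ≡ᵇ y)

∖-true⇒ : ∀ (P : ℕ → Bool) {y z} → (P ∖ y) z ≡ true → P z ≡ true × z ≢ y
∖-true⇒ P {y} {z} p with P z | z ≡ᵇ y in z≡ᵇy
... | true | false = refl , λ z≡y → contradiction (trans (sym z≡ᵇy) (≡⇒≡ᵇ-true z≡y)) λ ()

∖-true⇐ : ∀ (P : ℕ → Bool) {y z} → P z ≡ true → z ≢ y → (P ∖ y) z ≡ true
∖-true⇐ P Pz z≢y = cong₂ _∧_ Pz (cong not (≢⇒≡ᵇ-false z≢y))

count-remove : ∀ m (P : ℕ → Bool) y → y < m → P y ≡ true → count P m ≡ suc (count (P ∖ y) m)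
count-remove (suc m) P zero    _         Py rewrite Py =
  cong suc (sumBelow-cong m (λ j _ → cong indicator (sym (∧-identityʳ (P (suc j))))))
count-remove (suc m) P (suc y) (s<s y<m) Py
  rewrite count-remove m (P ∘ suc) y y<m Py | ∧-identityʳ (P 0) = +-suc _ _

count-≥1 : ∀ k (P : ℕ → Bool) {j} → j < k → P j ≡ true → 1 ≤ count P k
count-≥1 k P j<k Pj rewrite count-remove k P _ j<k Pj = s≤s z≤n

count-≥2 : ∀ k (P : ℕ → Bool) {j j'} → j < k → j' < k → j ≢ j' → P j ≡ true → P j' ≡ true →
  2 ≤ count P k
count-≥2 k P j<k j'<k j≢j' Pj Pj' rewrite count-remove k P _ j<k Pj =
  s≤s (count-≥1 k (P ∖ _) j'<k (∖-true⇐ P Pj' (j≢j' ∘ sym)))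

count-witness : ∀ k (P : ℕ → Bool) → 1 ≤ count P k → ∃[ j ] j < k × P j ≡ true
count-witness (suc k) P c with P 0 in P0
... | true  = 0 , z<s , P0
... | false with count-witness k (P ∘ suc) c
... | j , j<k , Pj = suc j , s<s j<k , Pj

count-≥2-other : ∀ k (P : ℕ → Bool) {y} → y < k → P y ≡ true → 2 ≤ count P k →
  ∃[ j ] j < k × P j ≡ true × j ≢ y
count-≥2-other k P y<k Py c
  rewrite count-remove k P _ y<k Py with count-witness k (P ∖ _) (≤-pred c)
... | j , j<k , p = j , j<k , ∖-true⇒ P p

count-≤1 : ∀ k (P : ℕ → Bool) → (∀ j j' → j < k → j' < k → P j ≡ true → P j' ≡ true → j ≡ j') →
  count P k ≤ 1
count-≤1 k P unique = ≮⇒≥ λ twice →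
  let y , y<k , Py       = count-witness k P (<⇒≤ twice)
      j , j<k , Pj , j≢y = count-≥2-other k P y<k Py twice
  in  j≢y (unique j y j<k y<k Pj Py)

Lands : (A B : ℕ → Bool) (mA mB : ℕ) → ℕ ⊎ ℕ → Set
Lands A B mA mB (inj₁ y) = y < mA × A y ≡ true
Lands A B mA mB (inj₂ y) = y < mB × B y ≡ true

Lands-remove : ∀ (A B : ℕ → Bool) mA mB w → Lands A B mA mB w →
  Σ (ℕ → Bool) λ A' → Σ (ℕ → Bool) λ B' →
    count A mA + count B mB ≡ suc (count A' mA + count B' mB)
    × (∀ v → Lands A B mA mB v → v ≢ w → Lands A' B' mA mB v)
Lands-remove A B mA mB (inj₁ y) (y<mA , Ay) =
  A ∖ y , B , cong (_+ count B mB) (count-remove mA A y y<mA Ay) , restrict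
  where
  restrict : ∀ v → Lands A B mA mB v → v ≢ inj₁ y → Lands (A ∖ y) B mA mB v
  restrict (inj₁ z) (z<mA , Az) z≢y = z<mA , ∖-true⇐ A Az (z≢y ∘ cong inj₁)
  restrict (inj₂ z) lands       _   = lands
Lands-remove A B mA mB (inj₂ y) (y<mB , By) =
  A , B ∖ y , trans (cong (count A mA +_) (count-remove mB B y y<mB By)) (+-suc _ _) , restrict
  where
  restrict : ∀ v → Lands A B mA mB v → v ≢ inj₂ y → Lands A (B ∖ y) mA mB v
  restrict (inj₁ z) lands       _   = lands
  restrict (inj₂ z) (z<mB , Bz) z≢y = z<mB , ∖-true⇐ B Bz (z≢y ∘ cong inj₂)

count-≤-injection : ∀ k (P A B : ℕ → Bool) mA mB
  (code : ∀ j → j < k → P j ≡ true → ℕ ⊎ ℕ) →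
  (∀ j j<k Pj → Lands A B mA mB (code j j<k Pj)) →
  (∀ j j' j<k j'<k Pj Pj' → code j j<k Pj ≡ code j' j'<k Pj' → j ≡ j') →
  count P k ≤ count A mA + count B mB
count-≤-injection zero    P A B mA mB code lands injective = z≤n
count-≤-injection (suc k) P A B mA mB code lands injective with P 0 in P0
... | false = count-≤-injection k (P ∘ suc) A B mA mB
  (λ j j<k → code (suc j) (s<s j<k)) (λ j j<k → lands (suc j) (s<s j<k))
  (λ j j' j<k j'<k Pj Pj' → suc-injective ∘ injective _ _ _ _ Pj Pj')
... | true with Lands-remove A B mA mB (code 0 z<s P0) (lands 0 z<s P0)
... | A' , B' , removed , restrict = subst (suc (count (P ∘ suc) k) ≤_) (sym removed) (s≤s
  (count-≤-injection k (P ∘ suc) A' B' mA mB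
    (λ j j<k → code (suc j) (s<s j<k))
    (λ j j<k Pj → restrict _ (lands (suc j) (s<s j<k) Pj) (1+n≢0 ∘ injective _ 0 _ z<s Pj P0))
    (λ j j' j<k j'<k Pj Pj' → suc-injective ∘ injective _ _ _ _ Pj Pj')))

all-applyUpTo⁻ : ∀ k (p : ℕ → Bool) (h : ℕ → ℕ) → all p (applyUpTo h k) ≡ true →
  ∀ j → j < k → p (h j) ≡ true
all-applyUpTo⁻ (suc k) p h ps zero    _         = proj₁ (∧-true⁻ (p (h 0)) ps)
all-applyUpTo⁻ (suc k) p h ps (suc j) (s<s j<k) = all-applyUpTo⁻ k p (h ∘ suc) (proj₂ (∧-true⁻ (p (h 0)) ps)) j j<k

all-applyUpTo⁺ : ∀ k (p : ℕ → Bool) (h : ℕ → ℕ) → (∀ j → j < k → p (h j) ≡ true) →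
  all p (applyUpTo h k) ≡ true
all-applyUpTo⁺ zero    p h ps = refl
all-applyUpTo⁺ (suc k) p h ps =
  cong₂ _∧_ (ps 0 z<s) (all-applyUpTo⁺ k p (h ∘ suc) (λ j → ps (suc j) ∘ s<s))

-- Occurrences and minimal unique substrings

SamePrefix : (T : ℕ → ℕ) (len x y : ℕ) → Set
SamePrefix T len x y = ∀ m → m < len → T (x + m) ≡ T (y + m)

SamePrefix-cons : ∀ {T : ℕ → ℕ} {len x y} → T x ≡ T y → SamePrefix T len (suc x) (suc y) →
  SamePrefix T (suc len) x y
SamePrefix-cons {T} {x = x} {y} head tail zero    _ =
  subst₂ (λ x' y' → T x' ≡ T y') (sym (+-identityʳ x)) (sym (+-identityʳ y)) head
SamePrefix-cons {T} {x = x} {y} head tail (suc m) (s<s m<len) =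
  subst₂ (λ x' y' → T x' ≡ T y') (sym (+-suc x m)) (sym (+-suc y m)) (tail m m<len)

SamePrefix-sym : ∀ {T : ℕ → ℕ} {len x y} → SamePrefix T len x y → SamePrefix T len y x
SamePrefix-sym same m m<len = sym (same m m<len)

SamePrefix-trans : ∀ {T : ℕ → ℕ} {len x y z} → SamePrefix T len x y → SamePrefix T len y z → SamePrefix T len x z
SamePrefix-trans same same' m m<len = trans (same m m<len) (same' m m<len)

record Occurrence (n : ℕ) (T : ℕ → ℕ) (b len c : ℕ) : Set where
  field
    1≤c     : 1 ≤ c
    fits    : c + len ≤ suc n
    matches : SamePrefix T len c b

occursAt-sound : ∀ n T b len c → occursAt n T b len c ≡ true → Occurrence n T b len c
occursAt-sound n T b len c p
  with starts , p₁    ← ∧-true⁻ (1 ≤ᵇ c) p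
  with fits , chars   ← ∧-true⁻ (c + len ≤ᵇ suc n) p₁
  = record
  { 1≤c     = ≤ᵇ-true⇒≤ starts
  ; fits    = ≤ᵇ-true⇒≤ fits
  ; matches = λ m m<len → ≡ᵇ-true⇒≡ (all-applyUpTo⁻ len _ id chars m m<len)
  }

occursAt-complete : ∀ n T b len c → Occurrence n T b len c → occursAt n T b len c ≡ true
occursAt-complete n T b len c o = cong₂ _∧_ (≤⇒≤ᵇ-true 1≤c) (cong₂ _∧_ (≤⇒≤ᵇ-true fits)
  (all-applyUpTo⁺ len _ id (λ m m<len → ≡⇒≡ᵇ-true (matches m m<len))))
  where open Occurrence o

occCount≡count : ∀ n T b len → occCount n T b len ≡ count (λ j → occursAt n T b len (suc j)) n
occCount≡count n T b len = sum-map-interval _ 1 n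

occCount-antitone : ∀ n T b {len len'} → len ≤ len' → occCount n T b len' ≤ occCount n T b len
occCount-antitone n T b {len} {len'} len≤len'
  rewrite occCount≡count n T b len | occCount≡count n T b len' = sumBelow-mono n shorter
  where
  shorter : ∀ j → j < n → indicator (occursAt n T b len' (suc j)) ≤ indicator (occursAt n T b len (suc j))
  shorter j _ with occursAt n T b len' (suc j) in occ
  ... | false = z≤n
  ... | true  = ≤-reflexive (cong indicator (sym (occursAt-complete n T b len (suc j) (record
    { 1≤c     = 1≤c
    ; fits    = ≤-trans (+-monoʳ-≤ (suc j) len≤len') fits
    ; matches = λ m m<len → matches m (<-≤-trans m<len len≤len')
    }))))
    where open Occurrence (occursAt-sound n T b len' (suc j) occ)

record MUS (n : ℕ) (T : ℕ → ℕ) (b e : ℕ) : Set where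
  field
    b≤e          : b ≤ e
    e≤n          : e ≤ n
    unique       : occCount n T b (suc e ∸ b) ≡ 1
    suffixRepeat : 2 ≤ occCount n T (suc b) (e ∸ b)
    prefixRepeat : 2 ≤ occCount n T b (e ∸ b)

isMUS-sound : ∀ n T b e → isMUS n T b e ≡ true → MUS n T b e
isMUS-sound n T b e p
  with _ , p₁               ← ∧-true⁻ (1 ≤ᵇ b) p
  with b≤e , p₂             ← ∧-true⁻ (b ≤ᵇ e) p₁
  with e≤n , p₃             ← ∧-true⁻ (e ≤ᵇ n) p₂
  with unique , p₄          ← ∧-true⁻ (occCount n T b (suc e ∸ b) ≡ᵇ 1) p₃
  with suffixRep , prefixRep ← ∧-true⁻ (2 ≤ᵇ occCount n T (suc b) (e ∸ b)) p₄
  = record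
  { b≤e          = ≤ᵇ-true⇒≤ b≤e
  ; e≤n          = ≤ᵇ-true⇒≤ e≤n
  ; unique       = ≡ᵇ-true⇒≡ unique
  ; suffixRepeat = ≤ᵇ-true⇒≤ suffixRep
  ; prefixRepeat = ≤ᵇ-true⇒≤ prefixRep
  }

MUS-fits : ∀ {n T b e} → MUS n T b e → suc (b + (e ∸ b)) ≤ suc n
MUS-fits mus = s≤s (≤-trans (≤-reflexive (m+[n∸m]≡n b≤e)) e≤n)
  where open MUS mus

MUS-end-≮ : ∀ {n T b e e'} → MUS n T b e → MUS n T b e' → ¬ e < e'
MUS-end-≮ {n} {T} {b} {e} {e'} mus mus' e<e' = <⇒≱ (MUS.prefixRepeat mus') (begin
  occCount n T b (e' ∸ b)        ≤⟨ occCount-antitone n T b (∸-monoˡ-≤ b e<e') ⟩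
  occCount n T b (suc e ∸ b)     ≡⟨ MUS.unique mus ⟩
  1                              ∎)
  where open ≤-Reasoning

MUS-end-unique : ∀ {n T b e e'} → MUS n T b e → MUS n T b e' → e ≡ e'
MUS-end-unique mus mus' = ≤-antisym (≮⇒≥ (MUS-end-≮ mus' mus)) (≮⇒≥ (MUS-end-≮ mus mus'))

musEnds : ℕ → (ℕ → ℕ) → ℕ → ℕ
musEnds n T b = count (λ k → isMUS n T b (b + k)) (suc n ∸ b)

musEnds-≤1 : ∀ n T b → musEnds n T b ≤ 1
musEnds-≤1 n T b = count-≤1 (suc n ∸ b) _ λ k k' _ _ mus mus' →
  +-cancelˡ-≡ b k k' (MUS-end-unique (isMUS-sound n T b _ mus) (isMUS-sound n T b _ mus'))

numMUS≡sumBelow-musEnds : ∀ n T → numMUS n T ≡ sumBelow (λ j → musEnds n T (suc j)) n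
numMUS≡sumBelow-musEnds n T = begin
  numMUS n T                              ≡⟨ sum-concatMap ends (interval 1 n) ⟩
  sum (map (sum ∘ ends) (interval 1 n))   ≡⟨ sum-map-interval (sum ∘ ends) 1 n ⟩
  sumBelow (λ j → sum (ends (suc j))) n   ≡⟨ sumBelow-cong n (λ j _ → sum-map-interval _ (suc j) n) ⟩
  sumBelow (λ j → musEnds n T (suc j)) n  ∎
  where
  open ≡-Reasoning
  ends : ℕ → List ℕ
  ends b = map (λ e → indicator (isMUS n T b e)) (interval b n)

startsMUS : ℕ → (ℕ → ℕ) → ℕ → Bool
startsMUS n T b = 1 ≤ᵇ musEnds n T b

numMUS-≤-starts : ∀ n T → numMUS n T ≤ count (λ j → startsMUS n T (suc j)) n
numMUS-≤-starts n T rewrite numMUS≡sumBelow-musEnds n T =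
  sumBelow-mono n (λ j _ → ≤1⇒≤-indicator (musEnds n T (suc j)) (musEnds-≤1 n T (suc j)))
  where
  ≤1⇒≤-indicator : ∀ x → x ≤ 1 → x ≤ indicator (1 ≤ᵇ x)
  ≤1⇒≤-indicator zero          _           = z≤n
  ≤1⇒≤-indicator (suc zero)    _           = ≤-refl
  ≤1⇒≤-indicator (suc (suc x)) (s≤s ())

startsMUS-witness : ∀ n T b → startsMUS n T b ≡ true → ∃[ e ] MUS n T b e
startsMUS-witness n T b starts with count-witness (suc n ∸ b) _ (≤ᵇ-true⇒≤ starts)
... | k , _ , mus = b + k , isMUS-sound n T b (b + k) mus

-- Suffix arrays

SuffixLess-irrefl : ∀ {n T p} → ¬ SuffixLess n T p p
SuffixLess-irrefl (_ , _ , inj₁ (n<p+k , p+k≤n)) = <⇒≱ n<p+k p+k≤n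
SuffixLess-irrefl (_ , _ , inj₂ (_ , _ , lt))     = <-irrefl refl lt

¬SuffixLess-at : ∀ {n T q r k} → SamePrefix T k q r → q + k ≤ n → T (r + k) < T (q + k) →
  ¬ SuffixLess n T q r
¬SuffixLess-at {q = q} {k = k} same q+k≤n r<q (k' , same' , diff) with <-cmp k' k | diff
... | tri< k'<k _ _ | inj₁ (n<q+k' , _)  = <⇒≱ n<q+k' (≤-trans (+-monoʳ-≤ q (<⇒≤ k'<k)) q+k≤n)
... | tri< k'<k _ _ | inj₂ (_ , _ , q<r) = <-irrefl (same k' k'<k) q<r
... | tri≈ _ refl _ | inj₁ (n<q+k , _)   = <⇒≱ n<q+k q+k≤n
... | tri≈ _ refl _ | inj₂ (_ , _ , q<r) = <-asym q<r r<q
... | tri> _ _ k<k' | _                  = <-irrefl (sym (same' k k<k')) r<q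

SuffixLess-between : ∀ {n T p q r len} → SuffixLess n T p q → SuffixLess n T q r →
  SamePrefix T len p r → p + len ≤ suc n → SamePrefix T len q p × q + len ≤ suc n
SuffixLess-between {n} {T} {p} {q} {r} {len} (k , same , diff) q<r p≈r p+len≤1+n with len ≤? k
... | yes len≤k =
  (λ m m<len → sym (same m (<-≤-trans m<len len≤k))) ,
  ≤-trans (+-monoʳ-≤ q len≤k) (m≤n⇒m≤1+n ([ proj₂ , proj₁ ∘ proj₂ ]′ diff))
... | no len≰k with diff
...   | inj₁ (n<p+k , _) = ⊥-elim (<⇒≱ n<p+k (s≤s⁻¹ (≤-trans (+-monoʳ-< p (≰⇒> len≰k)) p+len≤1+n)))
...   | inj₂ (_ , q+k≤n , p<q) = ⊥-elim (¬SuffixLess-at {T = T} same-qr q+k≤n r<q q<r)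
  where
  k<len : k < len
  k<len = ≰⇒> len≰k
  same-qr : SamePrefix T k q r
  same-qr m m<k = trans (sym (same m m<k)) (p≈r m (<-trans m<k k<len))
  r<q : T (r + k) < T (q + k)
  r<q = subst (_< T (q + k)) (p≈r k k<len) p<q

module SuffixArray (n : ℕ) (T SA : ℕ → ℕ) (isSA : IsSuffixArray n T SA) where

  bounded : ∀ i → 1 ≤ i → i ≤ n → 1 ≤ SA i × SA i ≤ n
  bounded = proj₁ isSA

  sorted : ∀ i j → 1 ≤ i → i < j → j ≤ n → SuffixLess n T (SA i) (SA j)
  sorted = proj₂ isSA

  SA-injective : ∀ {i j} → 1 ≤ i → i ≤ n → 1 ≤ j → j ≤ n → SA i ≡ SA j → i ≡ j
  SA-injective {i} {j} 1≤i i≤n 1≤j j≤n eq with <-cmp i j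
  ... | tri< i<j _ _ = ⊥-elim (SuffixLess-irrefl {T = T} (subst (λ p → SuffixLess n T p (SA j)) eq (sorted i j 1≤i i<j j≤n)))
  ... | tri≈ _ i≡j _ = i≡j
  ... | tri> _ _ j<i = ⊥-elim (SuffixLess-irrefl {T = T} (subst (λ p → SuffixLess n T p (SA i)) (sym eq) (sorted j i 1≤j j<i i≤n)))

  hits-every-position : ∀ {v} → 1 ≤ v → v ≤ n → 1 ≤ count (λ j → SA (suc j) ≡ᵇ v) n
  hits-every-position {v} 1≤v v≤n = ≮⇒≥ λ missed → 1+n≰n (begin
    suc (count (positive ∖ v) (suc n))          ≡⟨ removed ⟨
    count (λ _ → true) n                        ≤⟨ injection missed ⟩
    count (positive ∖ v) (suc n) + 0            ≡⟨ +-identityʳ _ ⟩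
    count (positive ∖ v) (suc n)                ∎)
    where
    open ≤-Reasoning
    positive : ℕ → Bool
    positive = 1 ≤ᵇ_
    -- count positive (suc n) reduces to count (λ _ → true) n
    removed : count (λ _ → true) n ≡ suc (count (positive ∖ v) (suc n))
    removed = count-remove (suc n) positive v (s≤s v≤n) (≤⇒≤ᵇ-true 1≤v)
    injection : count (λ j → SA (suc j) ≡ᵇ v) n < 1 →
      count (λ _ → true) n ≤ count (positive ∖ v) (suc n) + count (λ _ → false) 0
    injection missed = count-≤-injection n (λ _ → true) (positive ∖ v) (λ _ → false) (suc n) 0 (λ j _ _ → inj₁ (SA (suc j)))
      (λ j j<n _ → s≤s (proj₂ (bounded (suc j) (s≤s z≤n) j<n)) ,
                   ∖-true⇐ positive (≤⇒≤ᵇ-true (proj₁ (bounded (suc j) (s≤s z≤n) j<n))) (misses j j<n))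
      (λ j j' j<n j'<n _ _ eq → suc-injective (SA-injective (s≤s z≤n) j<n (s≤s z≤n) j'<n (inj₁-injective eq)))
      where
      misses : ∀ j → j < n → SA (suc j) ≢ v
      misses j j<n SAj≡v = <⇒≱ missed (count-≥1 n _ j<n (≡⇒≡ᵇ-true SAj≡v))

  SA-surjective : ∀ {v} → 1 ≤ v → v ≤ n → ∃[ i ] 1 ≤ i × i ≤ n × SA i ≡ v
  SA-surjective 1≤v v≤n with count-witness n _ (hits-every-position 1≤v v≤n)
  ... | j , j<n , SAj≡v = suc j , s≤s z≤n , j<n , ≡ᵇ-true⇒≡ SAj≡v

  occurrences-between : ∀ {x len i j k} → 1 ≤ i → i ≤ j → j ≤ k → k ≤ n →
    Occurrence n T x len (SA i) → Occurrence n T x len (SA k) → Occurrence n T x len (SA j)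
  occurrences-between {x} {len} {i} {j} {k} 1≤i i≤j j≤k k≤n occ-i occ-k
    with m≤n⇒m<n∨m≡n i≤j | m≤n⇒m<n∨m≡n j≤k
  ... | inj₂ refl | _         = occ-i
  ... | inj₁ _    | inj₂ refl = occ-k
  ... | inj₁ i<j  | inj₁ j<k  = record
    { 1≤c     = proj₁ (bounded j 1≤j j≤n)
    ; fits    = proj₂ squeezed
    ; matches = SamePrefix-trans {T} (proj₁ squeezed) (Occurrence.matches occ-i)
    }
    where
    1≤j : 1 ≤ j
    1≤j = ≤-trans 1≤i (<⇒≤ i<j)
    j≤n : j ≤ n
    j≤n = ≤-trans (<⇒≤ j<k) k≤n
    squeezed : SamePrefix T len (SA j) (SA i) × SA j + len ≤ suc n
    squeezed = SuffixLess-between {T = T} (sorted i j 1≤i i<j j≤n) (sorted j k 1≤j j<k k≤n)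
      (SamePrefix-trans {T} (Occurrence.matches occ-i) (SamePrefix-sym {T} (Occurrence.matches occ-k)))
      (Occurrence.fits occ-i)

-- Minimal unique substrings and BWT runs

runChange : (ℕ → ℕ) → ℕ → Bool
runChange L k = not (L (suc k) ≡ᵇ L (suc (suc k)))

module RunBoundaries (n : ℕ) (T SA : ℕ → ℕ) (isSA : IsSuffixArray n T SA)
                     (¬$ : ∀ i → 1 ≤ i → i < n → T i ≢ 1) where

  open SuffixArray n T SA isSA

  L : ℕ → ℕ
  L = BWT n T SA

  L-at : ∀ {i b} → SA i ≡ suc (suc b) → L i ≡ T (suc b)
  L-at SAi rewrite SAi = refl

  record UniqueLeftExtension (b len i : ℕ) : Set where
    field
      b+1<n  : suc b < n
      unique : occCount n T (suc b) (suc len) ≡ 1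
      fits   : suc b + suc len ≤ suc n
      1≤i    : 1 ≤ i
      i≤n    : i ≤ n
      rank   : SA i ≡ suc (suc b)

    occurrence : Occurrence n T (suc (suc b)) len (SA i)
    occurrence = record
      { 1≤c     = subst (1 ≤_) (sym rank) (s≤s z≤n)
      ; fits    = subst (_≤ suc n) (trans (+-suc (suc b) len) (cong (λ c → c + len) (sym rank))) fits
      ; matches = subst (λ c → SamePrefix T len c (suc (suc b))) (sym rank) (λ _ _ → refl)
      }

  other-occurrence-L-differs : ∀ {b len i j} → UniqueLeftExtension b len i →
    1 ≤ j → j ≤ n → j ≢ i → Occurrence n T (suc (suc b)) len (SA j) → L j ≢ L i
  other-occurrence-L-differs {b} {len} {i} {j} u 1≤j j≤n j≢i occ Lj≡Li with SA j in SAj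
  ... | zero        = contradiction (Occurrence.1≤c occ) λ ()
  ... | suc zero    = ¬$ (suc b) (s≤s z≤n) b+1<n (trans (sym (L-at rank)) (sym Lj≡Li))
    where open UniqueLeftExtension u
  -- L j = T (d+1) = T (b+1) extends the occurrence at d+2 to a second occurrence of T[b+1 .. b+1+len]
  ... | suc (suc d) = contradiction (subst (2 ≤_) unique twice) λ { (s≤s ()) }
    where
    open UniqueLeftExtension u
    occ-d : Occurrence n T (suc b) (suc len) (suc d)
    occ-d = record
      { 1≤c     = s≤s z≤n
      ; fits    = subst (_≤ suc n) (sym (+-suc (suc d) len)) (Occurrence.fits occ)
      ; matches = SamePrefix-cons {T} (trans Lj≡Li (L-at rank)) (Occurrence.matches occ)
      }
    occ-b : Occurrence n T (suc b) (suc len) (suc b)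
    occ-b = record { 1≤c = s≤s z≤n ; fits = fits ; matches = λ _ _ → refl }
    d≢b : d ≢ b
    d≢b refl = j≢i (SA-injective 1≤j j≤n 1≤i i≤n (trans SAj (sym rank)))
    twice : 2 ≤ occCount n T (suc b) (suc len)
    twice rewrite occCount≡count n T (suc b) (suc len) =
      count-≥2 n _ (≤-trans (m≤m+n (suc d) len) (s≤s⁻¹ (Occurrence.fits occ))) (<-trans (n<1+n b) b+1<n) d≢b
        (occursAt-complete n T (suc b) (suc len) (suc d) occ-d)
        (occursAt-complete n T (suc b) (suc len) (suc b) occ-b)

  record RunChangeNear (i : ℕ) : Set where
    field
      k       : ℕ
      k+2≤n   : suc (suc k) ≤ n
      changes : L (suc k) ≢ L (suc (suc k))
      side    : i ≡ suc k ⊎ i ≡ suc (suc k)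

  run-ends-at : ∀ {b len i i'} → UniqueLeftExtension b len i →
    i < i' → i' ≤ n → Occurrence n T (suc (suc b)) len (SA i') → RunChangeNear i
  run-ends-at {i = zero}  u _ _ _ = contradiction (UniqueLeftExtension.1≤i u) λ ()
  run-ends-at {i = suc k} u i<i' i'≤n occ' = record
    { k = k ; k+2≤n = ≤-trans i<i' i'≤n ; side = inj₁ refl
    ; changes = ≢-sym (other-occurrence-L-differs u (s≤s z≤n) (≤-trans i<i' i'≤n) 1+n≢n
        (occurrences-between 1≤i (n≤1+n _) i<i' i'≤n occurrence occ'))
    }
    where open UniqueLeftExtension u

  run-starts-at : ∀ {b len i i'} → UniqueLeftExtension b len i →
    1 ≤ i' → i' < i → Occurrence n T (suc (suc b)) len (SA i') → RunChangeNear i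
  run-starts-at {i = suc zero}    u 1≤i' (s≤s i'≤0)    _    = contradiction (≤-trans 1≤i' i'≤0) λ ()
  run-starts-at {i = suc (suc k)} u 1≤i' (s≤s i'≤i-1) occ' = record
    { k = k ; k+2≤n = i≤n ; side = inj₂ refl
    ; changes = other-occurrence-L-differs u (≤-trans 1≤i' i'≤i-1) (≤-trans (n≤1+n _) i≤n) (<⇒≢ (n<1+n _))
        (occurrences-between 1≤i' i'≤i-1 (n≤1+n _) i≤n occ' occurrence)
    }
    where open UniqueLeftExtension u

  run-change-near : ∀ {b len i i'} → UniqueLeftExtension b len i →
    1 ≤ i' → i' ≤ n → i' ≢ i → Occurrence n T (suc (suc b)) len (SA i') → RunChangeNear i
  run-change-near {i = i} {i'} u 1≤i' i'≤n i'≢i occ' with <-cmp i i'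
  ... | tri< i<i' _ _ = run-ends-at u i<i' i'≤n occ'
  ... | tri≈ _ i≡i' _ = contradiction (sym i≡i') i'≢i
  ... | tri> _ _ i'<i = run-starts-at u 1≤i' i'<i occ'

  MUS-unique-left-extension : ∀ {b e i} → suc b < n → MUS n T (suc b) e →
    1 ≤ i → i ≤ n → SA i ≡ suc (suc b) → UniqueLeftExtension b (e ∸ suc b) i
  MUS-unique-left-extension {b} {e} b+1<n mus 1≤i i≤n rank = record
    { b+1<n  = b+1<n
    ; unique = subst (λ l → occCount n T (suc b) l ≡ 1) (+-∸-assoc 1 b≤e) unique
    ; fits   = subst (_≤ suc n) (sym (+-suc (suc b) (e ∸ suc b))) (MUS-fits mus)
    ; 1≤i    = 1≤i
    ; i≤n    = i≤n
    ; rank   = rank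
    }
    where open MUS mus

  MUS-suffix-elsewhere : ∀ {b e} → suc b < n → MUS n T (suc b) e →
    ∃[ i' ] 1 ≤ i' × i' ≤ n × SA i' ≢ suc (suc b) × Occurrence n T (suc (suc b)) (e ∸ suc b) (SA i')
  MUS-suffix-elsewhere {b} {e} b+1<n mus with count-≥2-other n _ b+1<n own repeated
    where
    open MUS mus
    own : occursAt n T (suc (suc b)) (e ∸ suc b) (suc (suc b)) ≡ true
    own = occursAt-complete n T (suc (suc b)) (e ∸ suc b) (suc (suc b)) (record { 1≤c = s≤s z≤n ; fits = MUS-fits mus ; matches = λ _ _ → refl })
    repeated : 2 ≤ count (λ j → occursAt n T (suc (suc b)) (e ∸ suc b) (suc j)) n
    repeated = subst (2 ≤_) (occCount≡count n T _ _) suffixRepeat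
  ... | j , j<n , occ , j≢b+1 with SA-surjective (s≤s z≤n) j<n
  ...   | i' , 1≤i' , i'≤n , rank' =
    i' , 1≤i' , i'≤n , j≢b+1 ∘ suc-injective ∘ trans (sym rank') ,
    subst (Occurrence n T _ _) (sym rank') (occursAt-sound n T _ _ _ occ)

  MUS-near-run-change : ∀ {b e i} → suc b < n → MUS n T (suc b) e →
    1 ≤ i → i ≤ n → SA i ≡ suc (suc b) → RunChangeNear i
  MUS-near-run-change b+1<n mus 1≤i i≤n rank with MUS-suffix-elsewhere b+1<n mus
  ... | i' , 1≤i' , i'≤n , SAi'≢ , occ' =
    run-change-near (MUS-unique-left-extension b+1<n mus 1≤i i≤n rank) 1≤i' i'≤n
      (λ i'≡i → SAi'≢ (trans (cong SA i'≡i) rank)) occ'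

  tag : ∀ {i} → RunChangeNear i → ℕ ⊎ ℕ
  tag w = [ (λ _ → inj₁ k) , (λ _ → inj₂ k) ]′ side
    where open RunChangeNear w

  tag-injective : ∀ {i i'} (w : RunChangeNear i) (w' : RunChangeNear i') → tag w ≡ tag w' → i ≡ i'
  tag-injective record { side = inj₁ refl } record { side = inj₁ refl } refl = refl
  tag-injective record { side = inj₂ refl } record { side = inj₂ refl } refl = refl
  tag-injective record { side = inj₁ refl } record { side = inj₂ refl } ()
  tag-injective record { side = inj₂ refl } record { side = inj₁ refl } ()

  tag-lands : ∀ {i} (w : RunChangeNear i) → Lands (runChange L) (runChange L) (pred n) (pred n) (tag w)
  tag-lands record { k+2≤n = k+2≤n ; changes = ch ; side = inj₁ _ } = pred-mono-≤ k+2≤n , cong not (≢⇒≡ᵇ-false ch)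
  tag-lands record { k+2≤n = k+2≤n ; changes = ch ; side = inj₂ _ } = pred-mono-≤ k+2≤n , cong not (≢⇒≡ᵇ-false ch)

  MUS-start-near-run-change : ∀ {b} → suc b < n → startsMUS n T (suc b) ≡ true →
    ∃[ i ] SA i ≡ suc (suc b) × RunChangeNear i
  MUS-start-near-run-change {b} b+1<n starts =
    let _ , mus             = startsMUS-witness n T (suc b) starts
        i , 1≤i , i≤n , rank = SA-surjective (s≤s z≤n) b+1<n
    in  i , rank , MUS-near-run-change b+1<n mus 1≤i i≤n rank

runs≡1+count-runChange : ∀ n' T SA → runs (suc n') T SA ≡ suc (count (runChange (BWT (suc n') T SA)) n')
runs≡1+count-runChange n' T SA =
  cong suc (trans (sum-map-interval _ 1 n') (sumBelow-cong n' (λ j _ → negated (L (suc j) ≡ᵇ L (suc (suc j))))))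
  where
  L : ℕ → ℕ
  L = BWT (suc n') T SA
  negated : ∀ b → (if b then 0 else 1) ≡ indicator (not b)
  negated true  = refl
  negated false = refl

MUS-starts-≤-2·runChanges : ∀ n' T SA → IsSuffixArray (suc n') T SA → (∀ i → 1 ≤ i → i < suc n' → T i ≢ 1) →
  count (λ j → startsMUS (suc n') T (suc j)) n' ≤
    count (runChange (BWT (suc n') T SA)) n' + count (runChange (BWT (suc n') T SA)) n'
MUS-starts-≤-2·runChanges n' T SA isSA ¬$ =
  count-≤-injection n' _ _ _ n' n' (λ j j<n' starts → tag (near j j<n' starts))
    (λ j j<n' starts → tag-lands (near j j<n' starts)) injective
  where
  open RunBoundaries (suc n') T SA isSA ¬$
  located : ∀ {j} → j < n' → startsMUS (suc n') T (suc j) ≡ true →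
    ∃[ i ] SA i ≡ suc (suc j) × RunChangeNear i
  located j<n' = MUS-start-near-run-change (s≤s j<n')
  near : ∀ j (j<n' : j < n') starts → RunChangeNear (proj₁ (located j<n' starts))
  near j j<n' starts = proj₂ (proj₂ (located j<n' starts))
  injective : ∀ j j' (j<n' : j < n') (j'<n' : j' < n') starts starts' →
    tag (near j j<n' starts) ≡ tag (near j' j'<n' starts') → j ≡ j'
  injective j j' j<n' j'<n' starts starts' same = suc-injective (suc-injective (begin
    suc (suc j)                   ≡⟨ proj₁ (proj₂ (located j<n' starts)) ⟨
    SA (proj₁ (located j<n' starts))   ≡⟨ cong SA (tag-injective (near j j<n' starts) (near j' j'<n' starts') same) ⟩
    SA (proj₁ (located j'<n' starts')) ≡⟨ proj₁ (proj₂ (located j'<n' starts')) ⟩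
    suc (suc j')                  ∎))
    where open ≡-Reasoning

corollary1 : (σ n : ℕ) (T : ℕ → ℕ) (SA : ℕ → ℕ)
    → ValidText σ n T
    → IsSuffixArray n T SA
    → numMUS n T < 2 * runs n T SA
corollary1 σ zero     T SA valid isSA = contradiction (proj₁ valid) λ ()
corollary1 σ (suc n') T SA valid isSA = begin-strict
  numMUS n T                                  ≤⟨ numMUS-≤-starts n T ⟩
  count starts n                              ≡⟨ sumBelow-suc n' (indicator ∘ starts) ⟩
  count starts n' + indicator (starts n')     ≤⟨ +-mono-≤ (MUS-starts-≤-2·runChanges n' T SA isSA ¬$) (indicator-≤1 (starts n')) ⟩
  (changes + changes) + 1                     <⟨ ≤-reflexive (doubled changes) ⟩
  2 * suc changes                             ≡⟨ cong (2 *_) (runs≡1+count-runChange n' T SA) ⟨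
  2 * runs n T SA                             ∎
  where
  open ≤-Reasoning
  n : ℕ
  n = suc n'
  starts : ℕ → Bool
  starts j = startsMUS n T (suc j)
  changes : ℕ
  changes = count (runChange (BWT n T SA)) n'
  ¬$ : ∀ i → 1 ≤ i → i < n → T i ≢ 1
  ¬$ = proj₂ (proj₂ (proj₂ (proj₂ valid)))
  doubled : ∀ x → suc ((x + x) + 1) ≡ 2 * suc x
  doubled = solve-∀
  indicator-≤1 : ∀ b → indicator b ≤ 1
  indicator-≤1 true  = ≤-refl
  indicator-≤1 false = z≤n
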